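{- Let $k,l,m,i$ be integers with $0\le i\le k-2$ and $3\le k<l<m\le \frac{k+i-1}{2}+l$. Then $r(k,l,m)\ge k+2m-i-2$.
   Context: For a graph whose edges are coloured with red, blue and green, a red (resp. blue, green) $t$-connected matching is a connected component of the spanning subgraph formed by the red (resp. blue, green) edges whose maximum matching has size at least $t$. For positive integers $k,l,m$, $r(k,l,m)$ denotes the smallest integer $n$ such that every red-blue-green colouring of the edges of $K_{n,n}$ contains a red $k$-connected matching, or a blue $l$-connected matching, or a green $m$-connected matching. -}

module Defs where

open import Data.Nat using (ℕ)
open import Data.Fin using (Fin)
open import Data.Sum using (_⊎_; inj₁; inj₂)
open import Data.Product using (Σ; _×_)
open import Function.Definitions using (Injective)
open import Relation.Binary.PropositionalEquality using (_≡_)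

data Colour : Set where
  red blue green : Colour

-- A red-blue-green colouring of the edges of K_{n,n}: the left part and
-- the right part are both indexed by Fin n; c a b is the colour of the
-- edge between left vertex a and right vertex b.
Colouring : ℕ → Set
Colouring n = Fin n → Fin n → Colour

-- Vertices of K_{n,n}: inj₁ = left part, inj₂ = right part.
Vertex : ℕ → Set
Vertex n = Fin n ⊎ Fin n

data Adj {n : ℕ} (c : Colouring n) (col : Colour) : Vertex n → Vertex n → Set where
  lr : ∀ a b → c a b ≡ col → Adj c col (inj₁ a) (inj₂ b)
  rl : ∀ a b → c a b ≡ col → Adj c col (inj₂ b) (inj₁ a)

data Reach {n : ℕ} (c : Colouring n) (col : Colour) : Vertex n → Vertex n → Set where
  here : ∀ {u} → Reach c col u u
  step : ∀ {u v w} → Adj c col u v → Reach c col v w → Reach c col u w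

-- A component contains such a matching iff its maximum
-- matching has size at least t.
ConnMatching : {n : ℕ} → Colouring n → Colour → ℕ → Set
ConnMatching {n} c col t =
  Σ (Fin t → Fin n) λ f → Σ (Fin t → Fin n) λ g →
    Injective _≡_ _≡_ f × Injective _≡_ _≡_ g ×
    (∀ j → c (f j) (g j) ≡ col) ×
    (∀ j j' → Reach c col (inj₁ (f j)) (inj₁ (f j')))

RamseyProp : ℕ → ℕ → ℕ → ℕ → Set
RamseyProp k l m n =
  (c : Colouring n) → ConnMatching c red k ⊎ ConnMatching c blue l ⊎ ConnMatching c green m

-- "r(k,l,m) ≥ N": r(k,l,m) is the least n with RamseyProp k l m n, so
-- r(k,l,m) ≥ N means every n with the property satisfies N ≤ n.
RamseyAtLeast : ℕ → ℕ → ℕ → ℕ → Set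
RamseyAtLeast k l m N = ∀ n → RamseyProp k l m n → N Data.Nat.≤ n

module Submission where

-- Write k′ = k − 1, l′ = l − 1, m′ = m − 1.  Split the left side of K_{n,n}
-- into blocks X₁, X₂, X₃, X₄ of sizes l′, l′, k′ and n − 2l′ − k′, and the
-- right side into blocks Y₁, Y₂, Y₃ of sizes m′, m′ and n − 2m′, and colour
-- each edge by the pair of blocks it joins.  In every colour, every component
-- of the block graph is a star whose centre block has at most k′ (red),
-- l′ (blue) or m′ (green) vertices, and a matching inside a component uses
-- distinct vertices of its centre.  The hypotheses make the last blocks on
-- both sides have at most k′ vertices whenever n < k + 2m − i − 2.

open import Defs
open import Data.Nat using (ℕ; suc; _+_; _*_; _∸_; _≤_; _<_; z≤n; s≤s; _<?_)
open import Data.Nat.Properties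
open import Data.Nat.Tactic.RingSolver using (solve)
open import Data.Fin using (Fin; toℕ; fromℕ<) renaming (zero to fzero)
open import Data.Fin.Properties using (injective⇒≤; toℕ-fromℕ<; toℕ<n; toℕ-injective)
open import Data.List using ([]; _∷_)
open import Data.Sum using (_⊎_; inj₁; inj₂; [_,_])
open import Data.Product using (Σ; _×_; _,_; proj₁; proj₂)
open import Function.Definitions using (Injective)
open import Relation.Nullary using (¬_; yes; no)
open import Relation.Binary.PropositionalEquality using (_≡_; refl; sym; trans; cong; subst; module ≡-Reasoning)

record AtMost {n : ℕ} (s : ℕ) (P : Fin n → Set) : Set where
  constructor atMost
  field
    injection-≤ : ∀ {t} (f : Fin t → Fin n) → Injective _≡_ _≡_ f → (∀ j → P (f j)) → t ≤ s

open AtMost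

AtMost-≤ : ∀ {n s s′} {P : Fin n → Set} → s ≤ s′ → AtMost s P → AtMost s′ P
AtMost-≤ s≤s′ small = atMost λ f f-inj inside → ≤-trans (injection-≤ small f f-inj inside) s≤s′

AtMost-⊆ : ∀ {n s} {P Q : Fin n → Set} → (∀ {x} → P x → Q x) → AtMost s Q → AtMost s P
AtMost-⊆ P⊆Q small = atMost λ f f-inj inside → injection-≤ small f f-inj (λ j → P⊆Q (inside j))

InInterval : ℕ → ℕ → ℕ → Set
InInterval lo s x = lo ≤ x × x < lo + s

injection-into-interval-≤ : ∀ {n t} lo s (f : Fin t → Fin n) → Injective _≡_ _≡_ f →
  (∀ j → InInterval lo s (toℕ (f j))) → t ≤ s
injection-into-interval-≤ {t = t} lo s f f-inj inside = injective⇒≤ offset-injective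
  where
  offset<s : ∀ j → toℕ (f j) ∸ lo < s
  offset<s j = subst (toℕ (f j) ∸ lo <_) (m+n∸m≡n lo s)
                     (∸-monoˡ-< (proj₂ (inside j)) (proj₁ (inside j)))

  offset : Fin t → Fin s
  offset j = fromℕ< (offset<s j)

  offset-injective : Injective _≡_ _≡_ offset
  offset-injective {i} {j} eq = f-inj (toℕ-injective (begin
    toℕ (f i)                 ≡⟨ sym (m∸n+n≡m (proj₁ (inside i))) ⟩
    toℕ (f i) ∸ lo + lo       ≡⟨ cong (_+ lo) (sym (toℕ-fromℕ< (offset<s i))) ⟩
    toℕ (offset i) + lo       ≡⟨ cong (λ x → toℕ x + lo) eq ⟩
    toℕ (offset j) + lo       ≡⟨ cong (_+ lo) (toℕ-fromℕ< (offset<s j)) ⟩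
    toℕ (f j) ∸ lo + lo       ≡⟨ m∸n+n≡m (proj₁ (inside j)) ⟩
    toℕ (f j)                 ∎))
    where open ≡-Reasoning

AtMost-interval : ∀ {n} lo s → AtMost {n} s (λ x → InInterval lo s (toℕ x))
AtMost-interval lo s = atMost (injection-into-interval-≤ lo s)

Reach-preserves : ∀ {n} {c : Colouring n} {col} {L : Set} (label : Vertex n → L) →
  (∀ {u v} → Adj c col u v → label u ≡ label v) →
  ∀ {u v} → Reach c col u v → label u ≡ label v
Reach-preserves label adj-preserves here       = refl
Reach-preserves label adj-preserves (step e r) =
  trans (adj-preserves e) (Reach-preserves label adj-preserves r)

IsEndpoint : {A B : Set} → A ⊎ B → A → B → Set
IsEndpoint (inj₁ x′) x y = x ≡ x′
IsEndpoint (inj₂ y′) x y = y ≡ y′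

-- The hub of a block names its component in the graph of col-edges between
-- blocks; every col-edge meets the hub of its component, so components are stars.
record Hubs {A B : Set} (table : A → B → Colour) (col : Colour) : Set where
  field
    hubL : A → A ⊎ B
    hubR : B → A ⊎ B
    hub-agrees   : ∀ x y → table x y ≡ col → hubL x ≡ hubR y
    hub-endpoint : ∀ x y → table x y ≡ col → IsEndpoint (hubL x) x y

module BlockColouring {n : ℕ} {A B : Set}
  (blockL : Fin n → A) (blockR : Fin n → B) (table : A → B → Colour) where

  colouring : Colouring n
  colouring a b = table (blockL a) (blockR b)

  Members : A ⊎ B → Fin n → Set
  Members (inj₁ x) a = blockL a ≡ x
  Members (inj₂ y) b = blockR b ≡ y

  ConnMatching-≤ : ∀ {col s t} (H : Hubs table col) →
    (∀ x → AtMost s (Members (Hubs.hubL H x))) →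
    ConnMatching colouring col t → t ≤ s
  ConnMatching-≤ {col} {s} {0}     H small _ = z≤n
  ConnMatching-≤ {col} {s} {suc t} H small (f , g , f-inj , g-inj , coloured , connected) =
    centre-bound (hubL (blockL (f fzero))) (small (blockL (f fzero))) ends-at-centre
    where
    open Hubs H

    hub : Vertex n → A ⊎ B
    hub (inj₁ a) = hubL (blockL a)
    hub (inj₂ b) = hubR (blockR b)

    adj-preserves-hub : ∀ {u v} → Adj colouring col u v → hub u ≡ hub v
    adj-preserves-hub (lr a b e) = hub-agrees _ _ e
    adj-preserves-hub (rl a b e) = sym (hub-agrees _ _ e)

    ends-at-centre : ∀ j → IsEndpoint (hubL (blockL (f fzero))) (blockL (f j)) (blockR (g j))
    ends-at-centre j = subst (λ h → IsEndpoint h (blockL (f j)) (blockR (g j)))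
      (Reach-preserves hub adj-preserves-hub (connected j fzero))
      (hub-endpoint _ _ (coloured j))

    centre-bound : ∀ h → AtMost s (Members h) →
      (∀ j → IsEndpoint h (blockL (f j)) (blockR (g j))) → suc t ≤ s
    centre-bound (inj₁ x) small-x ends = injection-≤ small-x f f-inj ends
    centre-bound (inj₂ y) small-y ends = injection-≤ small-y g g-inj ends

data Left : Set where
  X₁ X₂ X₃ X₄ : Left

data Right : Set where
  Y₁ Y₂ Y₃ : Right

table : Left → Right → Colour
table X₁ Y₁ = blue
table X₁ Y₂ = green
table X₁ Y₃ = red
table X₂ Y₁ = green
table X₂ Y₂ = blue
table X₂ Y₃ = red
table X₃ Y₁ = green
table X₃ Y₂ = red
table X₃ Y₃ = blue
table X₄ Y₁ = red
table X₄ Y₂ = green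
table X₄ Y₃ = blue

hubL : Colour → Left → Left ⊎ Right
hubL red   X₁ = inj₂ Y₃
hubL red   X₂ = inj₂ Y₃
hubL red   X₃ = inj₁ X₃
hubL red   X₄ = inj₁ X₄
hubL blue  X₁ = inj₁ X₁
hubL blue  X₂ = inj₁ X₂
hubL blue  X₃ = inj₂ Y₃
hubL blue  X₄ = inj₂ Y₃
hubL green X₁ = inj₂ Y₂
hubL green X₂ = inj₂ Y₁
hubL green X₃ = inj₂ Y₁
hubL green X₄ = inj₂ Y₂

hubR : Colour → Right → Left ⊎ Right
hubR red   Y₁ = inj₁ X₄
hubR red   Y₂ = inj₁ X₃
hubR red   Y₃ = inj₂ Y₃
hubR blue  Y₁ = inj₁ X₁
hubR blue  Y₂ = inj₁ X₂
hubR blue  Y₃ = inj₂ Y₃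
hubR green y  = inj₂ y

hub-edge : ∀ x y → let col = table x y in
  hubL col x ≡ hubR col y × IsEndpoint (hubL col x) x y
hub-edge X₁ Y₁ = refl , refl
hub-edge X₁ Y₂ = refl , refl
hub-edge X₁ Y₃ = refl , refl
hub-edge X₂ Y₁ = refl , refl
hub-edge X₂ Y₂ = refl , refl
hub-edge X₂ Y₃ = refl , refl
hub-edge X₃ Y₁ = refl , refl
hub-edge X₃ Y₂ = refl , refl
hub-edge X₃ Y₃ = refl , refl
hub-edge X₄ Y₁ = refl , refl
hub-edge X₄ Y₂ = refl , refl
hub-edge X₄ Y₃ = refl , refl

hubs : ∀ col → Hubs table col
hubs col = record
  { hubL = hubL col
  ; hubR = hubR col
  ; hub-agrees   = λ x y e → subst (λ c → hubL c x ≡ hubR c y) e (proj₁ (hub-edge x y))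
  ; hub-endpoint = λ x y e → subst (λ c → IsEndpoint (hubL c x) x y) e (proj₂ (hub-edge x y))
  }

module LowerBoundColouring (k l m n : ℕ) (k≤l : k ≤ l)
  (n≤2m+k : n ≤ m + m + k) (n≤2l+2k : n ≤ l + l + k + k) where

  leftStart leftSize : Left → ℕ
  leftStart X₁ = 0
  leftStart X₂ = l
  leftStart X₃ = l + l
  leftStart X₄ = l + l + k
  leftSize X₁ = l
  leftSize X₂ = l
  leftSize X₃ = k
  leftSize X₄ = k

  rightStart rightSize : Right → ℕ
  rightStart Y₁ = 0
  rightStart Y₂ = m
  rightStart Y₃ = m + m
  rightSize Y₁ = m
  rightSize Y₂ = m
  rightSize Y₃ = k

  locateLeft : (a : Fin n) → Σ Left λ X → InInterval (leftStart X) (leftSize X) (toℕ a)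
  locateLeft a with toℕ a <? l
  ... | yes x<l = X₁ , z≤n , x<l
  ... | no x≮l with toℕ a <? l + l
  ...   | yes x<2l = X₂ , ≮⇒≥ x≮l , x<2l
  ...   | no x≮2l with toℕ a <? l + l + k
  ...     | yes x<2l+k = X₃ , ≮⇒≥ x≮2l , x<2l+k
  ...     | no x≮2l+k = X₄ , ≮⇒≥ x≮2l+k , <-≤-trans (toℕ<n a) n≤2l+2k

  locateRight : (b : Fin n) → Σ Right λ Y → InInterval (rightStart Y) (rightSize Y) (toℕ b)
  locateRight b with toℕ b <? m
  ... | yes y<m = Y₁ , z≤n , y<m
  ... | no y≮m with toℕ b <? m + m
  ...   | yes y<2m = Y₂ , ≮⇒≥ y≮m , y<2m
  ...   | no y≮2m = Y₃ , ≮⇒≥ y≮2m , <-≤-trans (toℕ<n b) n≤2m+k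

  open BlockColouring (λ a → proj₁ (locateLeft a)) (λ b → proj₁ (locateRight b)) table

  size : Left ⊎ Right → ℕ
  size (inj₁ X) = leftSize X
  size (inj₂ Y) = rightSize Y

  AtMost-block : ∀ h → AtMost (size h) (Members h)
  AtMost-block (inj₁ X) = AtMost-⊆ left-interval (AtMost-interval (leftStart X) (leftSize X))
    where
    left-interval : ∀ {a} → Members (inj₁ X) a → InInterval (leftStart X) (leftSize X) (toℕ a)
    left-interval {a} refl = proj₂ (locateLeft a)
  AtMost-block (inj₂ Y) = AtMost-⊆ right-interval (AtMost-interval (rightStart Y) (rightSize Y))
    where
    right-interval : ∀ {b} → Members (inj₂ Y) b → InInterval (rightStart Y) (rightSize Y) (toℕ b)
    right-interval {b} refl = proj₂ (locateRight b)

  bound : Colour → ℕ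
  bound red   = k
  bound blue  = l
  bound green = m

  hub-size : ∀ col x → size (hubL col x) ≤ bound col
  hub-size red   X₁ = ≤-refl
  hub-size red   X₂ = ≤-refl
  hub-size red   X₃ = ≤-refl
  hub-size red   X₄ = ≤-refl
  hub-size blue  X₁ = ≤-refl
  hub-size blue  X₂ = ≤-refl
  hub-size blue  X₃ = k≤l
  hub-size blue  X₄ = k≤l
  hub-size green X₁ = ≤-refl
  hub-size green X₂ = ≤-refl
  hub-size green X₃ = ≤-refl
  hub-size green X₄ = ≤-refl

  no-ConnMatching : ∀ col → ¬ ConnMatching colouring col (suc (bound col))
  no-ConnMatching col M = 1+n≰n (ConnMatching-≤ (hubs col)
    (λ x → AtMost-≤ (hub-size col x) (AtMost-block (hubL col x))) M)

  ¬RamseyProp : ¬ RamseyProp (suc k) (suc l) (suc m) n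
  ¬RamseyProp rp =
    [ no-ConnMatching red , [ no-ConnMatching blue , no-ConnMatching green ] ] (rp colouring)

RamseyAtLeast-∸ : ∀ {k l m} p q → (∀ n → n + p < q → ¬ RamseyProp k l m n) →
  RamseyAtLeast k l m (q ∸ p)
RamseyAtLeast-∸ p q small n rp =
  m≤n+o⇒m∸n≤o q p (subst (q ≤_) (+-comm n p) (≮⇒≥ (λ n+p<q → small n n+p<q rp)))

n+i≤2m+k : ∀ n i k m → n + (i + 2) < suc k + 2 * suc m → n + i ≤ m + m + k
n+i≤2m+k n i k m lt = +-cancelʳ-≤ 3 _ _ (begin
  n + i + 3          ≡⟨ solve (n ∷ i ∷ []) ⟩
  suc (n + (i + 2))  ≤⟨ lt ⟩
  suc k + 2 * suc m  ≡⟨ solve (k ∷ m ∷ []) ⟩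
  m + m + k + 3      ∎)
  where open ≤-Reasoning

2m≤k+i+2l : ∀ k l m i → 2 * suc m + 1 ≤ suc k + i + 2 * suc l → m + m ≤ k + i + (l + l)
2m≤k+i+2l k l m i le = +-cancelʳ-≤ 3 _ _ (begin
  m + m + 3                ≡⟨ solve (m ∷ []) ⟩
  2 * suc m + 1            ≤⟨ le ⟩
  suc k + i + 2 * suc l    ≡⟨ solve (k ∷ i ∷ l ∷ []) ⟩
  k + i + (l + l) + 3      ∎)
  where open ≤-Reasoning

n≤2l+2k : ∀ n i k l m → n + i ≤ m + m + k → m + m ≤ k + i + (l + l) → n ≤ l + l + k + k
n≤2l+2k n i k l m n+i≤ 2m≤ = +-cancelʳ-≤ i _ _ (begin
  n + i                ≤⟨ n+i≤ ⟩
  m + m + k            ≤⟨ +-monoˡ-≤ k 2m≤ ⟩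
  k + i + (l + l) + k  ≡⟨ solve (k ∷ i ∷ l ∷ []) ⟩
  l + l + k + k + i    ∎)
  where open ≤-Reasoning

lemma4p1 : (k l m i : ℕ) → i + 2 ≤ k → 3 ≤ k → k < l → l < m →
    2 * m + 1 ≤ k + i + 2 * l →
    RamseyAtLeast k l m ((k + 2 * m) ∸ (i + 2))
-- Apart from making k, l, m positive, only k < l and the bound on 2m are used.
lemma4p1 (suc k) (suc l) (suc m) i _ _ (s≤s k<l) _ 2m+1≤ =
  RamseyAtLeast-∸ (i + 2) (suc k + 2 * suc m) λ n n+i+2< →
    let n+i≤ = n+i≤2m+k n i k m n+i+2<
        2m≤  = 2m≤k+i+2l k l m i 2m+1≤
    in LowerBoundColouring.¬RamseyProp k l m n (<⇒≤ k<l)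
         (≤-trans (m≤m+n n i) n+i≤) (n≤2l+2k n i k l m n+i≤ 2m≤)
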